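{- Let $P$ be a finite connected ranked poset and let $\sigma$ be any permutation of the ranks $0,1,\dots,r$ of $P$. Let $\mathcal{O}$ be an orbit of $\Phi_{\mathrm{row}(\sigma)}$ acting on $J(P)$. Then the distribution on $J(P)$ that is uniform on $\mathcal{O}$ and zero outside $\mathcal{O}$ is toggle-symmetric.
   Context: $P$ is ranked if there is $\mathrm{rk}:P\to\mathbb{N}$ with $0$ in its image and $\mathrm{rk}(q)=\mathrm{rk}(p)+1$ whenever $q$ covers $p$; $r:=\max\mathrm{rk}$. $J(P)$ is the set of order ideals of $P$. For $p\in P$ the toggle $\tau_p:J(P)\to J(P)$ is $\tau_p(I)=I\cup\{p\}$ if $p\notin I$ and $p$ is minimal in $P\setminus I$; $I\setminus\{p\}$ if $p\in I$ is maximal in $I$; $I$ otherwise. $\tau_i$ is the composition of all $\tau_p$ with $\mathrm{rk}(p)=i$ (these commute), and $\Phi_{\mathrm{row}(\sigma)}:=\tau_{\sigma(0)}\circ\tau_{\sigma(1)}\circ\cdots\circ\tau_{\sigma(r)}$. $\mathcal{T}^+_p(I)=1$ if $p$ can be toggled into $I$ (first case above), else 0; $\mathcal{T}^-_p(I)=1$ if $p$ can be toggled out (second case), else 0. A distribution $\mu$ on $J(P)$ is toggle-symmetric if $\mathbb{E}(\mu;\mathcal{T}^+_p)=\mathbb{E}(\mu;\mathcal{T}^-_p)$ for all $p\in P$. -}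

module Defs where

open import Level using (0ℓ)
open import Data.Nat as ℕ using (ℕ; zero; suc; _<_; _⊔_)
open import Data.Bool using (Bool; true; false; not; _∧_; _∨_; if_then_else_)
open import Data.Fin as Fin using (Fin; toℕ)
open import Data.Fin.Properties using (all?)
open import Data.Fin.Permutation using (Permutation′; _⟨$⟩ʳ_)
open import Data.Vec as Vec using (Vec; []; _∷_; lookup; updateAt)
open import Data.List as List using (List; []; _∷_; allFin; upTo; foldr; filter; map; _++_)
open import Data.List.Membership.DecPropositional using ()
open import Data.List.Relation.Unary.Any using (any?)
open import Data.Rational as ℚ using (ℚ; 0ℚ; 1ℚ; _+_; _*_)
open import Data.Integer using (+_)
open import Data.Product using (Σ; ∃; _×_; _,_)
open import Data.Sum using (_⊎_)
open import Relation.Nullary using (Dec; ¬_)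
open import Relation.Nullary.Decidable using (⌊_⌋)
open import Relation.Binary using (Rel; Decidable; IsPartialOrder)
open import Relation.Binary.PropositionalEquality using (_≡_; _≢_)
import Data.Vec.Properties as VecP
import Data.Bool.Properties as BoolP

record FinPoset : Set₁ where
  field
    n      : ℕ
    _≼_    : Rel (Fin n) 0ℓ
    _≼?_   : Decidable _≼_
    isPO   : IsPartialOrder _≡_ _≼_

  _≺_ : Rel (Fin n) 0ℓ
  p ≺ q = (p ≼ q) × (p ≢ q)

  ltB : Fin n → Fin n → Bool
  ltB p q = ⌊ p ≼? q ⌋ ∧ not ⌊ p Fin.≟ q ⌋

  _⋖_ : Rel (Fin n) 0ℓ
  p ⋖ q = (p ≺ q) × (∀ z → p ≺ z → z ≺ q → Data.Empty.⊥)
    where import Data.Empty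

open FinPoset public

data Zigzag (P : FinPoset) : Fin (n P) → Fin (n P) → Set where
  here  : ∀ {p} → Zigzag P p p
  up    : ∀ {p q s} → _≼_ P p q → Zigzag P q s → Zigzag P p s
  down  : ∀ {p q s} → _≼_ P q p → Zigzag P q s → Zigzag P p s

Connected : FinPoset → Set
Connected P = ∀ p q → Zigzag P p q

IsRankFunction : (P : FinPoset) → (Fin (n P) → ℕ) → Set
IsRankFunction P rk =
  (∃ λ p → rk p ≡ 0) × (∀ p q → _⋖_ P p q → rk q ≡ suc (rk p))

maxRank : (P : FinPoset) → (Fin (n P) → ℕ) → ℕ
maxRank P rk = foldr (λ p m → rk p ⊔ m) 0 (allFin (n P))

Sub : FinPoset → Set
Sub P = Vec Bool (n P)

allB : (P : FinPoset) → (Fin (n P) → Bool) → Bool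
allB P f = foldr (λ q b → f q ∧ b) true (allFin (n P))

isIdealB : (P : FinPoset) → Sub P → Bool
isIdealB P I = allB P (λ q → allB P (λ p →
  not ⌊ _≼?_ P p q ⌋ ∨ not (lookup I q) ∨ lookup I p))

canAddB : (P : FinPoset) → Fin (n P) → Sub P → Bool
canAddB P p I = not (lookup I p) ∧ allB P (λ q → not (ltB P q p) ∨ lookup I q)

canRemoveB : (P : FinPoset) → Fin (n P) → Sub P → Bool
canRemoveB P p I = lookup I p ∧ allB P (λ q → not (ltB P p q) ∨ not (lookup I q))

toggle : (P : FinPoset) → Fin (n P) → Sub P → Sub P
toggle P p I =
  if canAddB P p I then updateAt I p (λ _ → true)
  else if canRemoveB P p I then updateAt I p (λ _ → false)
  else I

-- τ_i : composition of all τ_p with rk p = i (these commute; we compose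
-- them in the order of Fin)
toggleRank : (P : FinPoset) → (Fin (n P) → ℕ) → ℕ → Sub P → Sub P
toggleRank P rk i I =
  foldr (λ p J → if ⌊ rk p ℕ.≟ i ⌋ then toggle P p J else J) I (allFin (n P))

-- Φ_row(σ) = τ_σ(0) ∘ τ_σ(1) ∘ ⋯ ∘ τ_σ(r)
rowmotion : (P : FinPoset) (rk : Fin (n P) → ℕ) →
            Permutation′ (suc (maxRank P rk)) → Sub P → Sub P
rowmotion P rk σ I =
  foldr (λ i J → toggleRank P rk (toℕ (σ ⟨$⟩ʳ i)) J) I (allFin (suc (maxRank P rk)))

iterate : ∀ {A : Set} → (A → A) → ℕ → A → A
iterate f zero    x = x
iterate f (suc k) x = f (iterate f k x)

allSubs : (m : ℕ) → List (Vec Bool m)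
allSubs zero    = [] ∷ []
allSubs (suc m) = map (true ∷_) (allSubs m) ++ map (false ∷_) (allSubs m)

idealsJ : (P : FinPoset) → List (Sub P)
idealsJ P = filter (λ I → isIdealB P I BoolP.≟ true) (allSubs (n P))

Distribution : FinPoset → Set
Distribution P = Sub P → ℚ

boolℚ : Bool → ℚ
boolℚ true  = 1ℚ
boolℚ false = 0ℚ

expect : (P : FinPoset) → Distribution P → (Sub P → Bool) → ℚ
expect P μ f = foldr (λ I s → μ I * boolℚ (f I) + s) 0ℚ (idealsJ P)

ToggleSymmetric : (P : FinPoset) → Distribution P → Set
ToggleSymmetric P μ =
  ∀ p → expect P μ (canAddB P p) ≡ expect P μ (canRemoveB P p)

orbitList : ∀ {A : Set} → (A → A) → A → ℕ → List A
orbitList f x k = map (λ j → iterate f j x) (upTo k)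

uniformOnOrbit : (P : FinPoset) → (Sub P → Sub P) → Sub P → (k : ℕ) →
                 .{{ℕ.NonZero k}} → Distribution P
uniformOnOrbit P Φ I₀ k I =
  if ⌊ any? (λ J → VecP.≡-dec BoolP._≟_ I J) (orbitList Φ I₀ k) ⌋
  then (+ 1) ℚ./ k else 0ℚ

-- Fix p of rank i and an orbit I₀, I₁ = Φ I₀, …, I_k = I₀. Whether p lies in I_{j+1} is decided
-- by toggling p in the ideal J_j reached just before τ_i while computing Φ I_j, and J_j agrees with
-- I_j at p. Addability and removability of p in an ideal depend only on the covers of p; these have
-- ranks i ∓ 1, so in J_j they agree with I_j or with I_{j+1}, according to whether τ_{i∓1} comes
-- after or before τ_i. Over a period p enters as often as it leaves, and a telescoping argument shows
-- that the number of j with p addable to I_j equals the number of entries (dually for removals).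
-- Hence T⁺_p and T⁻_p have the same sum over the orbit.

module Submission where

open import Defs
open import Data.Bool using (Bool; true; false; not; _∧_; _∨_; if_then_else_)
open import Data.Bool.Properties as BoolP using (not-involutive; ¬-not)
open import Data.Fin as Fin using (Fin; toℕ; fromℕ<)
open import Data.Fin.Permutation using (Permutation′; _⟨$⟩ʳ_; _⟨$⟩ˡ_; inverseˡ; inverseʳ)
open import Data.Fin.Properties using (toℕ-injective; toℕ-fromℕ<)
import Data.Integer as ℤ
open import Data.List using (List; []; _∷_; _++_; allFin; foldr; map; applyUpTo; upTo)
open import Data.List.Membership.Propositional using (_∈_; _∉_)
open import Data.List.Membership.Propositional.Properties
  using (∈-allFin; ∈-map⁺; ∈-map⁻; ∈-∃++; ∈-++⁺ˡ; ∈-++⁺ʳ; ∈-filter⁺)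
open import Data.List.Properties using (foldr-map; foldr-++; map-applyUpTo)
open import Data.List.Relation.Binary.Disjoint.Propositional using (Disjoint)
open import Data.List.Relation.Unary.All as All using (All; _∷_)
import Data.List.Relation.Unary.All.Properties as AllP
open import Data.List.Relation.Unary.AllPairs as AllPairs using (_∷_)
open import Data.List.Relation.Unary.Any as Any using (here; there; any?)
open import Data.List.Relation.Unary.Unique.Propositional using (Unique)
open import Data.List.Relation.Unary.Unique.Propositional.Properties
  using (allFin⁺; applyUpTo⁺₁; map⁺; ++⁺; filter⁺)
open import Data.Nat as ℕ using (ℕ; zero; suc; pred; _+_; _∸_; _≤_; _<_; _⊔_; s≤s; z≤n)
open import Data.Nat.Induction using (<-wellFounded)
open import Data.List.Membership.DecPropositional ℕ._≟_ using (_∈?_)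
open import Data.Nat.Properties
  using (+-commutativeSemigroup; +-comm; +-cancelʳ-≡; +-identityʳ; +-mono-≤; +-mono-≤-<; +-monoʳ-<;
         ≤-refl; <⇒≤; <-≤-trans; m≤m+n; m∸n+n≡m; m<n⇒0<n∸m; m≤m⊔n; m≤n⇒m≤o⊔n; 1+n≢n)
open import Data.Nat.Tactic.RingSolver using (solve-∀)
open import Data.Product using (∃₂; ∃-syntax; _×_; _,_; proj₁; proj₂)
open import Data.Rational as ℚ using (ℚ; 0ℚ)
import Data.Rational.Properties as ℚP
open import Data.Sum as Sum using (_⊎_; inj₁; inj₂; [_,_])
open import Data.Vec using (Vec; []; _∷_; lookup)
open import Data.Vec.Properties as VecP using (lookup∘updateAt; lookup∘updateAt′; ∷-injectiveʳ)
open import Function using (_∘_; id)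
open import Induction.WellFounded as WF using ()
open import Level using (0ℓ)
open import Relation.Binary using (Decidable; DecidableEquality; IsPartialOrder)
import Relation.Binary.Construct.NonStrictToStrict as NonStrictToStrict
import Relation.Binary.Construct.On as On
open import Relation.Binary.PropositionalEquality
  using (_≡_; _≢_; refl; sym; trans; cong; cong₂; subst; module ≡-Reasoning)
open import Relation.Nullary using (Dec; yes; no; does; ¬_; contradiction)
open import Relation.Nullary.Decidable using (⌊_⌋; _×-dec_; dec-true; dec-false)
open import Algebra.Properties.CommutativeSemigroup +-commutativeSemigroup
  using () renaming (interchange to +-interchange)
open import Algebra.Properties.Monoid.Mult ℚP.+-0-monoid using () renaming (_×_ to _×ℚ_)

⟦_⟧ : Bool → ℕ
⟦ true  ⟧ = 1
⟦ false ⟧ = 0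

∑< : ℕ → (ℕ → ℕ) → ℕ
∑< zero    f = 0
∑< (suc k) f = f 0 + ∑< k (f ∘ suc)

syntax ∑< k (λ j → e) = ∑[ j < k ] e

∑-cong : ∀ k {f g : ℕ → ℕ} → (∀ j → f j ≡ g j) → ∑< k f ≡ ∑< k g
∑-cong zero    f≡g = refl
∑-cong (suc k) f≡g = cong₂ _+_ (f≡g 0) (∑-cong k (f≡g ∘ suc))

∑-distrib-+ : ∀ k (f g : ℕ → ℕ) → ∑[ j < k ] (f j + g j) ≡ ∑< k f + ∑< k g
∑-distrib-+ zero    f g = refl
∑-distrib-+ (suc k) f g
  rewrite ∑-distrib-+ k (f ∘ suc) (g ∘ suc) = +-interchange (f 0) (g 0) _ _

∑-+-cong : ∀ k {f g h i : ℕ → ℕ} → (∀ j → f j + g j ≡ h j + i j) →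
           ∑< k f + ∑< k g ≡ ∑< k h + ∑< k i
∑-+-cong k {f} {g} {h} {i} eq = begin
  ∑< k f + ∑< k g           ≡⟨ ∑-distrib-+ k f g ⟨
  ∑[ j < k ] (f j + g j)    ≡⟨ ∑-cong k eq ⟩
  ∑[ j < k ] (h j + i j)    ≡⟨ ∑-distrib-+ k h i ⟩
  ∑< k h + ∑< k i           ∎
  where open ≡-Reasoning

∑-shift : ∀ k (f : ℕ → ℕ) → ∑< k (f ∘ suc) + f 0 ≡ ∑< k f + f k
∑-shift zero    f = refl
∑-shift (suc k) f = begin
  f 1 + ∑< k (f ∘ suc ∘ suc) + f 0   ≡⟨ cong (_+ f 0) (+-comm (f 1) _) ⟩
  ∑< k (f ∘ suc ∘ suc) + f 1 + f 0   ≡⟨ cong (_+ f 0) (∑-shift k (f ∘ suc)) ⟩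
  ∑< k (f ∘ suc) + f (suc k) + f 0   ≡⟨ rearrange (∑< k (f ∘ suc)) (f (suc k)) (f 0) ⟩
  f 0 + ∑< k (f ∘ suc) + f (suc k)   ∎
  where
  open ≡-Reasoning
  rearrange : ∀ a b c → a + b + c ≡ c + a + b
  rearrange = solve-∀

∑-rotate : ∀ k (f : ℕ → ℕ) → f k ≡ f 0 → ∑< k (f ∘ suc) ≡ ∑< k f
∑-rotate k f fk≡f0 =
  +-cancelʳ-≡ (f 0) _ _ (trans (∑-shift k f) (cong (∑< k f +_) fk≡f0))

countᵇ : ∀ {A : Set} → (A → Bool) → List A → ℕ
countᵇ f []       = 0
countᵇ f (x ∷ xs) = ⟦ f x ⟧ + countᵇ f xs

private
  ⟦⟧-mono : ∀ {a b} → (a ≡ true → b ≡ true) → ⟦ a ⟧ ≤ ⟦ b ⟧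
  ⟦⟧-mono {false} a⇒b = z≤n
  ⟦⟧-mono {true}  a⇒b rewrite a⇒b refl = ≤-refl

countᵇ-mono : ∀ {A : Set} {f g : A → Bool} → (∀ x → f x ≡ true → g x ≡ true) →
              ∀ xs → countᵇ f xs ≤ countᵇ g xs
countᵇ-mono f⇒g []       = z≤n
countᵇ-mono f⇒g (x ∷ xs) = +-mono-≤ (⟦⟧-mono (f⇒g x)) (countᵇ-mono f⇒g xs)

countᵇ-mono-< : ∀ {A : Set} {f g : A → Bool} → (∀ x → f x ≡ true → g x ≡ true) →
                ∀ {xs x} → x ∈ xs → f x ≡ false → g x ≡ true → countᵇ f xs < countᵇ g xs
countᵇ-mono-< f⇒g {x ∷ xs} (here refl) fx gx rewrite fx | gx = s≤s (countᵇ-mono f⇒g xs)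
countᵇ-mono-< f⇒g {y ∷ xs} (there x∈xs) fx gx =
  +-mono-≤-< (⟦⟧-mono (f⇒g y)) (countᵇ-mono-< f⇒g x∈xs fx gx)

countᵇ-map : ∀ {A B : Set} (f : B → Bool) (h : A → B) xs → countᵇ f (map h xs) ≡ countᵇ (f ∘ h) xs
countᵇ-map f h []       = refl
countᵇ-map f h (x ∷ xs) = cong (⟦ f (h x) ⟧ +_) (countᵇ-map f h xs)

countᵇ-applyUpTo : ∀ {A : Set} (f : A → Bool) (h : ℕ → A) k →
                   countᵇ f (applyUpTo h k) ≡ ∑[ j < k ] ⟦ f (h j) ⟧
countᵇ-applyUpTo f h zero    = refl
countᵇ-applyUpTo f h (suc k) = cong (⟦ f (h 0) ⟧ +_) (countᵇ-applyUpTo f (h ∘ suc) k)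

countᵇ-+ : ∀ {A : Set} {f g h : A → Bool} → (∀ x → ⟦ f x ⟧ ≡ ⟦ g x ⟧ + ⟦ h x ⟧) →
           ∀ xs → countᵇ f xs ≡ countᵇ g xs + countᵇ h xs
countᵇ-+ split []       = refl
countᵇ-+ {f = f} {g} {h} split (x ∷ xs)
  rewrite split x | countᵇ-+ split xs = +-interchange ⟦ g x ⟧ ⟦ h x ⟧ (countᵇ g xs) (countᵇ h xs)

countᵇ-none : ∀ {A : Set} {f : A → Bool} xs → (∀ {x} → x ∈ xs → f x ≡ false) → countᵇ f xs ≡ 0
countᵇ-none []       none = refl
countᵇ-none (x ∷ xs) none rewrite none (here refl) = countᵇ-none xs (none ∘ there)

module MembershipCount {A : Set} (_≟_ : DecidableEquality A) where

  _∈ᵇ_ : A → List A → Bool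
  x ∈ᵇ ys = ⌊ any? (x ≟_) ys ⌋

  countᵇ-≡ : ∀ {xs} → Unique xs → ∀ {y} → y ∈ xs → (f : A → Bool) →
             countᵇ (λ x → ⌊ x ≟ y ⌋ ∧ f x) xs ≡ ⟦ f y ⟧
  countᵇ-≡ {x ∷ xs} (x∉xs ∷ _) {y} (here refl) f with y ≟ y
  ... | no  y≢y = contradiction refl y≢y
  ... | yes _   = trans (cong (⟦ f y ⟧ +_) (countᵇ-none xs others)) (+-identityʳ _)
    where
    others : ∀ {z} → z ∈ xs → ⌊ z ≟ y ⌋ ∧ f z ≡ false
    others {z} z∈xs with z ≟ y
    ... | yes refl = contradiction refl (All.lookup x∉xs z∈xs)
    ... | no  _    = refl
  countᵇ-≡ {x ∷ xs} (x∉xs ∷ unique) {y} (there y∈xs) f with x ≟ y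
  ... | yes refl = contradiction refl (All.lookup x∉xs y∈xs)
  ... | no  _    = countᵇ-≡ unique y∈xs f

  countᵇ-∈ᵇ : ∀ {xs ys} → Unique xs → Unique ys → All (_∈ xs) ys → (f : A → Bool) →
              countᵇ (λ x → x ∈ᵇ ys ∧ f x) xs ≡ countᵇ f ys
  countᵇ-∈ᵇ {xs} {[]}     _ _ _ f = countᵇ-none xs λ _ → refl
  countᵇ-∈ᵇ {xs} {y ∷ ys} xs-unique (y∉ys ∷ ys-unique) (y∈xs ∷ ys⊆xs) f = begin
    countᵇ (λ x → x ∈ᵇ (y ∷ ys) ∧ f x) xs
      ≡⟨ countᵇ-+ split xs ⟩
    countᵇ (λ x → ⌊ x ≟ y ⌋ ∧ f x) xs + countᵇ (λ x → x ∈ᵇ ys ∧ f x) xs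
      ≡⟨ cong₂ _+_ (countᵇ-≡ xs-unique y∈xs f) (countᵇ-∈ᵇ xs-unique ys-unique ys⊆xs f) ⟩
    ⟦ f y ⟧ + countᵇ f ys ∎
    where
    open ≡-Reasoning
    split : ∀ x → ⟦ x ∈ᵇ (y ∷ ys) ∧ f x ⟧ ≡ ⟦ ⌊ x ≟ y ⌋ ∧ f x ⟧ + ⟦ x ∈ᵇ ys ∧ f x ⟧
    split x with x ≟ y | any? (x ≟_) ys
    ... | no  _    | yes _    = refl
    ... | no  _    | no  _    = refl
    ... | yes refl | yes y∈ys = contradiction y∈ys (AllP.All¬⇒¬Any y∉ys)
    ... | yes refl | no  _    with f y
    ...   | true  = refl
    ...   | false = refl

toggleBit : Bool → Bool → Bool → Bool
toggleBit a addable removable = if a then not removable else addable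

not-toggleBit : ∀ a x y → not (toggleBit a x y) ≡ toggleBit (not a) y x
not-toggleBit false x y = refl
not-toggleBit true  x y = not-involutive y

module Periodic (k : ℕ) where

  entering leaving : (ℕ → Bool) → ℕ → ℕ
  entering a j = ⟦ not (a j) ∧ a (suc j) ⟧
  leaving  a j = ⟦ a j ∧ not (a (suc j)) ⟧

  ∑entering≡∑leaving : (a : ℕ → Bool) → a k ≡ a 0 →
                       ∑< k (entering a) ≡ ∑< k (leaving a)
  ∑entering≡∑leaving a ak≡a0 = +-cancelʳ-≡ _ _ _ (begin
    ∑< k (entering a) + ∑< k (⟦_⟧ ∘ a)
      ≡⟨ ∑-+-cong k (λ j → flow (a j) (a (suc j))) ⟩
    ∑< k (leaving a) + ∑< k (⟦_⟧ ∘ a ∘ suc)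
      ≡⟨ cong (∑< k (leaving a) +_) (∑-rotate k (⟦_⟧ ∘ a) (cong ⟦_⟧ ak≡a0)) ⟩
    ∑< k (leaving a) + ∑< k (⟦_⟧ ∘ a) ∎)
    where
    open ≡-Reasoning
    flow : ∀ x y → ⟦ not x ∧ y ⟧ + ⟦ x ⟧ ≡ ⟦ x ∧ not y ⟧ + ⟦ y ⟧
    flow false false = refl
    flow false true  = refl
    flow true  false = refl
    flow true  true  = refl

  module _ (a l add rem : ℕ → Bool) (ak≡a0 : a k ≡ a 0) (lk≡l0 : l k ≡ l 0)
           (step : ∀ j → a (suc j) ≡ toggleBit (a j) (add j) (rem j))
           (add-when-in : ∀ j → a j ≡ true → add j ≡ true)
           where

    private
      enters-iff-addable : ∀ j → entering a j ≡ ⟦ not (a j) ∧ add j ⟧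
      enters-iff-addable j rewrite step j with a j
      ... | false = refl
      ... | true  = refl

      balance : ∀ j → ⟦ not (a j) ∧ add j ⟧ + leaving a j
                      ≡ ⟦ not (a (suc j)) ∧ add j ⟧ + entering a j
      balance j rewrite step j with a j | add j | rem j | add-when-in j
      ... | false | false | _ | _ = refl
      ... | false | true  | _ | _ = refl
      ... | true  | true  | false | _ = refl
      ... | true  | true  | true  | _ = refl
      ... | true  | false | _ | in⇒add with in⇒add refl
      ...   | ()

    ∑addable≡∑entering : (∀ j → add j ≡ l j) ⊎ (∀ j → add j ≡ l (suc j)) →
                         ∑[ j < k ] ⟦ not (a j) ∧ l j ⟧ ≡ ∑< k (entering a)
    ∑addable≡∑entering (inj₁ add≡l) = ∑-cong k λ j →
      trans (cong (λ x → ⟦ not (a j) ∧ x ⟧) (sym (add≡l j))) (sym (enters-iff-addable j))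
    ∑addable≡∑entering (inj₂ add≡l∘suc) = sym (+-cancelʳ-≡ _ _ _ (begin
      ∑< k (entering a) + ∑< k (entering a)
        ≡⟨ cong₂ _+_ (∑-cong k enters-iff-addable) (∑entering≡∑leaving a ak≡a0) ⟩
      ∑[ j < k ] ⟦ not (a j) ∧ add j ⟧ + ∑< k (leaving a)
        ≡⟨ ∑-+-cong k balance ⟩
      ∑[ j < k ] ⟦ not (a (suc j)) ∧ add j ⟧ + ∑< k (entering a)
        ≡⟨ cong (_+ ∑< k (entering a)) (trans (∑-cong k λ j → cong (λ x → ⟦ not (a (suc j)) ∧ x ⟧) (add≡l∘suc j))
                                               (∑-rotate k (λ j → ⟦ not (a j) ∧ l j ⟧) l-periodic)) ⟩
      ∑[ j < k ] ⟦ not (a j) ∧ l j ⟧ + ∑< k (entering a) ∎))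
      where
      open ≡-Reasoning
      l-periodic : ⟦ not (a k) ∧ l k ⟧ ≡ ⟦ not (a 0) ∧ l 0 ⟧
      l-periodic = cong₂ (λ x y → ⟦ not x ∧ y ⟧) ak≡a0 lk≡l0

  -- Removal is addition for the complementary sequence not ∘ a, with add and rem swapped.
  ∑addable≡∑removable : (a l u add rem : ℕ → Bool) → a k ≡ a 0 → l k ≡ l 0 → u k ≡ u 0 →
    (∀ j → a (suc j) ≡ toggleBit (a j) (add j) (rem j)) →
    (∀ j → a j ≡ true → add j ≡ true) → (∀ j → a j ≡ false → rem j ≡ true) →
    (∀ j → add j ≡ l j) ⊎ (∀ j → add j ≡ l (suc j)) →
    (∀ j → rem j ≡ u j) ⊎ (∀ j → rem j ≡ u (suc j)) →
    ∑[ j < k ] ⟦ not (a j) ∧ l j ⟧ ≡ ∑[ j < k ] ⟦ a j ∧ u j ⟧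
  ∑addable≡∑removable a l u add rem ak≡a0 lk≡l0 uk≡u0 step add-when-in rem-when-out add≈l rem≈u =
    begin
      ∑[ j < k ] ⟦ not (a j) ∧ l j ⟧
        ≡⟨ ∑addable≡∑entering a l add rem ak≡a0 lk≡l0 step add-when-in add≈l ⟩
      ∑< k (entering a)
        ≡⟨ ∑entering≡∑leaving a ak≡a0 ⟩
      ∑< k (leaving a)
        ≡⟨ ∑-cong k (λ j → cong (λ x → ⟦ x ∧ not (a (suc j)) ⟧) (sym (not-involutive (a j)))) ⟩
      ∑< k (entering (not ∘ a))
        ≡⟨ ∑addable≡∑entering (not ∘ a) u rem add (cong not ak≡a0) uk≡u0 step-not rem-when-out′ rem≈u ⟨
      ∑[ j < k ] ⟦ not (not (a j)) ∧ u j ⟧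
        ≡⟨ ∑-cong k (λ j → cong (λ x → ⟦ x ∧ u j ⟧) (not-involutive (a j))) ⟩
      ∑[ j < k ] ⟦ a j ∧ u j ⟧ ∎
    where
    open ≡-Reasoning
    step-not : ∀ j → not (a (suc j)) ≡ toggleBit (not (a j)) (rem j) (add j)
    step-not j = trans (cong not (step j)) (not-toggleBit (a j) (add j) (rem j))
    rem-when-out′ : ∀ j → not (a j) ≡ true → rem j ≡ true
    rem-when-out′ j out = rem-when-out j (trans (sym (not-involutive (a j))) (cong not out))

false≢true : false ≢ true
false≢true ()

foldr-∧-true⇒ : ∀ {A : Set} (f : A → Bool) {xs} → foldr (λ x b → f x ∧ b) true xs ≡ true →
                ∀ {x} → x ∈ xs → f x ≡ true
foldr-∧-true⇒ f {y ∷ xs} all with f y in fy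
... | true = λ { (here refl) → fy ; (there x∈xs) → foldr-∧-true⇒ f all x∈xs }

foldr-∧-true⇐ : ∀ {A : Set} (f : A → Bool) xs → (∀ x → f x ≡ true) →
                foldr (λ x b → f x ∧ b) true xs ≡ true
foldr-∧-true⇐ f []       all = refl
foldr-∧-true⇐ f (x ∷ xs) all rewrite all x = foldr-∧-true⇐ f xs all

Unique-middle⁻ : ∀ {A : Set} (xs : List A) {y ys} → Unique (xs ++ y ∷ ys) →
                 y ∉ xs × y ∉ ys × (∀ {z} → z ∈ ys → z ∉ xs)
Unique-middle⁻ []       (y∉ys ∷ _) = (λ ()) , (λ y∈ys → All.lookup y∉ys y∈ys refl) , (λ _ ())
Unique-middle⁻ (x ∷ xs) (x∉rest ∷ unique) with Unique-middle⁻ xs unique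
... | y∉xs , y∉ys , disjoint =
  (λ { (here refl) → All.lookup x∉rest (∈-++⁺ʳ xs (here refl)) refl ; (there y∈xs) → y∉xs y∈xs }) ,
  y∉ys ,
  (λ { z∈ys (here refl)    → All.lookup x∉rest (∈-++⁺ʳ xs (there z∈ys)) refl
     ; z∈ys (there z∈xs) → disjoint z∈ys z∈xs })

≤-foldr-⊔ : ∀ {A : Set} (f : A → ℕ) {xs x} → x ∈ xs → f x ≤ foldr (λ y m → f y ⊔ m) 0 xs
≤-foldr-⊔ f (here refl)  = m≤m⊔n _ _
≤-foldr-⊔ f {y ∷ _} (there x∈xs) = m≤n⇒m≤o⊔n (f y) (≤-foldr-⊔ f x∈xs)

iterate-+ : ∀ {A : Set} (f : A → A) m n x → iterate f (m + n) x ≡ iterate f m (iterate f n x)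
iterate-+ f zero    n x = refl
iterate-+ f (suc m) n x = cong f (iterate-+ f m n x)

countᵇ-orbitList : ∀ {A : Set} (g : A → Bool) (f : A → A) x k →
                   countᵇ g (orbitList f x k) ≡ ∑[ j < k ] ⟦ g (iterate f j x) ⟧
countᵇ-orbitList g f x k =
  trans (countᵇ-map g (λ j → iterate f j x) (upTo k)) (countᵇ-applyUpTo _ id k)

orbitList-unique : ∀ {A : Set} (f : A → A) x k → iterate f k x ≡ x →
                   (∀ j → 0 < j → j < k → iterate f j x ≢ x) → Unique (orbitList f x k)
orbitList-unique f x k period minimal =
  subst Unique (sym (map-applyUpTo id (λ j → iterate f j x) k))
    (applyUpTo⁺₁ (λ j → iterate f j x) k distinct)
  where
  distinct : ∀ {i j} → i < j → j < k → iterate f i x ≢ iterate f j x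
  distinct {i} {j} i<j j<k fⁱx≡fʲx = minimal (k ∸ j + i) (<-≤-trans (m<n⇒0<n∸m j<k) (m≤m+n _ i))
    (subst (k ∸ j + i <_) (m∸n+n≡m (<⇒≤ j<k)) (+-monoʳ-< (k ∸ j) i<j)) (begin
      iterate f (k ∸ j + i) x             ≡⟨ iterate-+ f (k ∸ j) i x ⟩
      iterate f (k ∸ j) (iterate f i x)   ≡⟨ cong (iterate f (k ∸ j)) fⁱx≡fʲx ⟩
      iterate f (k ∸ j) (iterate f j x)   ≡⟨ iterate-+ f (k ∸ j) j x ⟨
      iterate f (k ∸ j + j) x             ≡⟨ cong (λ m → iterate f m x) (m∸n+n≡m (<⇒≤ j<k)) ⟩
      iterate f k x                       ≡⟨ period ⟩
      x                                   ∎)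
    where open ≡-Reasoning

does-true⇒ : ∀ {A : Set} (a? : Dec A) → does a? ≡ true → A
does-true⇒ (yes a) _ = a

module FinPosetProperties (P : FinPoset) where

  open FinPoset P public using () renaming (_≼_ to _≤ₚ_; _≺_ to _<ₚ_; _⋖_ to _⋖ₚ_)
  open IsPartialOrder (isPO P) using () renaming (refl to ≤ₚ-refl; trans to ≤ₚ-trans)

  _<ₚ?_ : Decidable _<ₚ_
  _<ₚ?_ = NonStrictToStrict.<-decidable _≡_ _≤ₚ_ Fin._≟_ (_≼?_ P)

  ltB⇒<ₚ : ∀ {p q} → ltB P p q ≡ true → p <ₚ q
  ltB⇒<ₚ {p} {q} lt with _≼?_ P p q | p Fin.≟ q
  ... | yes p≤q | no p≢q = p≤q , p≢q

  <ₚ⇒ltB : ∀ {p q} → p <ₚ q → ltB P p q ≡ true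
  <ₚ⇒ltB {p} {q} (p≤q , p≢q) with _≼?_ P p q | p Fin.≟ q
  ... | yes _   | no _    = refl
  ... | yes _   | yes p≡q = contradiction p≡q p≢q
  ... | no p≰q  | _       = contradiction p≤q p≰q

  <ₚ-trans : ∀ {x y z} → x <ₚ y → y <ₚ z → x <ₚ z
  <ₚ-trans = NonStrictToStrict.<-trans _≡_ _≤ₚ_ (isPO P)

  <ₚ-irrefl : ∀ {x} → ¬ x <ₚ x
  <ₚ-irrefl = NonStrictToStrict.<-irrefl _≡_ _≤ₚ_ refl

  Between : Fin (n P) → Fin (n P) → Fin (n P) → Set
  Between x y z = x <ₚ z × z <ₚ y

  Between? : ∀ x y z → Dec (Between x y z)
  Between? x y z = x <ₚ? z ×-dec z <ₚ? y

  between : Fin (n P) → Fin (n P) → ℕ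
  between x y = countᵇ (does ∘ Between? x y) (allFin (n P))

  between-shrink : ∀ {x y x′ y′} (z : Fin (n P)) → (∀ {w} → Between x′ y′ w → Between x y w) →
                   Between x y z → ¬ Between x′ y′ z → between x′ y′ < between x y
  between-shrink {x} {y} {x′} {y′} z narrow z∈ z∉ =
    countᵇ-mono-< (λ w → dec-true (Between? x y w) ∘ narrow ∘ does-true⇒ (Between? x′ y′ w))
      (∈-allFin z) (dec-false (Between? x′ y′ z) z∉) (dec-true (Between? x y z) z∈)

  between-shrinkˡ : ∀ {x z y} → x <ₚ z → z <ₚ y → between z y < between x y
  between-shrinkˡ x<z z<y = between-shrink _ (λ (z<w , w<y) → <ₚ-trans x<z z<w , w<y)
    (x<z , z<y) (λ (z<z , _) → <ₚ-irrefl z<z)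

  between-shrinkʳ : ∀ {x z y} → x <ₚ z → z <ₚ y → between x z < between x y
  between-shrinkʳ x<z z<y = between-shrink _ (λ (x<w , w<z) → x<w , <ₚ-trans w<z z<y)
    (x<z , z<y) (λ (_ , z<z) → <ₚ-irrefl z<z)

  ⋖-or-between : ∀ {x y} → x <ₚ y → x ⋖ₚ y ⊎ ∃[ z ] Between x y z
  ⋖-or-between {x} {y} x<y with any? (Between? x y) (allFin (n P))
  ... | yes some = inj₂ (Any.satisfied some)
  ... | no none  = inj₁ (x<y , λ z x<z z<y → none (Any.map (λ { refl → x<z , z<y }) (∈-allFin z)))

  ⋖-below : ∀ {x y} → x <ₚ y → ∃[ z ] x ≤ₚ z × z ⋖ₚ y
  ⋖-below {x} {y} = WF.All.wfRec (On.wellFounded (λ x → between x y) <-wellFounded) 0ℓ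
    (λ x → x <ₚ y → ∃[ z ] x ≤ₚ z × z ⋖ₚ y) step x
    where
    step : ∀ x → (∀ {x′} → between x′ y < between x y → x′ <ₚ y → ∃[ z ] x′ ≤ₚ z × z ⋖ₚ y) →
           x <ₚ y → ∃[ z ] x ≤ₚ z × z ⋖ₚ y
    step x rec x<y with ⋖-or-between x<y
    ... | inj₁ x⋖y = x , ≤ₚ-refl , x⋖y
    ... | inj₂ (z , x<z , z<y) with rec (between-shrinkˡ x<z z<y) z<y
    ...   | w , z≤w , w⋖y = w , ≤ₚ-trans (proj₁ x<z) z≤w , w⋖y

  ⋖-above : ∀ {x y} → x <ₚ y → ∃[ z ] x ⋖ₚ z × z ≤ₚ y
  ⋖-above {x} {y} = WF.All.wfRec (On.wellFounded (between x) <-wellFounded) 0ℓ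
    (λ y → x <ₚ y → ∃[ z ] x ⋖ₚ z × z ≤ₚ y) step y
    where
    step : ∀ y → (∀ {y′} → between x y′ < between x y → x <ₚ y′ → ∃[ z ] x ⋖ₚ z × z ≤ₚ y′) →
           x <ₚ y → ∃[ z ] x ⋖ₚ z × z ≤ₚ y
    step y rec x<y with ⋖-or-between x<y
    ... | inj₁ x⋖y = y , x⋖y , ≤ₚ-refl
    ... | inj₂ (z , x<z , z<y) with rec (between-shrinkʳ x<z z<y) x<z
    ...   | w , x⋖w , w≤z = w , x⋖w , ≤ₚ-trans w≤z (proj₁ z<y)

module IdealProperties (P : FinPoset) where

  open FinPosetProperties P

  allB⇒ : ∀ {f} → allB P f ≡ true → ∀ q → f q ≡ true
  allB⇒ {f} all q = foldr-∧-true⇒ f all (∈-allFin q)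

  allB⇐ : ∀ {f} → (∀ q → f q ≡ true) → allB P f ≡ true
  allB⇐ {f} = foldr-∧-true⇐ f (allFin (n P))

  record IsIdeal (I : Sub P) : Set where
    constructor downClosed
    field
      closed : ∀ {x y} → x ≤ₚ y → lookup I y ≡ true → lookup I x ≡ true

  open IsIdeal public

  closedᶜ : ∀ {I} → IsIdeal I → ∀ {x y} → x ≤ₚ y → lookup I x ≡ false → lookup I y ≡ false
  closedᶜ ideal x≤y x∉I = ¬-not λ y∈I → false≢true (trans (sym x∉I) (closed ideal x≤y y∈I))

  isIdealB⇒ : ∀ {I} → isIdealB P I ≡ true → IsIdeal I
  isIdealB⇒ {I} idealB = downClosed closed′
    where
    closed′ : ∀ {x y} → x ≤ₚ y → lookup I y ≡ true → lookup I x ≡ true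
    closed′ {x} {y} x≤y y∈I with _≼?_ P x y | allB⇒ (allB⇒ idealB y) x
    ... | yes _   | x∈I rewrite y∈I = x∈I
    ... | no x≰y  | _   = contradiction x≤y x≰y

  isIdealB⇐ : ∀ {I} → IsIdeal I → isIdealB P I ≡ true
  isIdealB⇐ {I} ideal = allB⇐ λ y → allB⇐ λ x → related x y
    where
    related : ∀ x y → (not ⌊ _≼?_ P x y ⌋ ∨ not (lookup I y) ∨ lookup I x) ≡ true
    related x y with _≼?_ P x y | lookup I y in y∈I
    ... | no _    | _     = refl
    ... | yes _   | false = refl
    ... | yes x≤y | true  rewrite closed ideal x≤y y∈I = refl

  allBelowIn noneAboveIn : Sub P → Fin (n P) → Bool
  allBelowIn  I p = allB P (λ q → not (ltB P q p) ∨ lookup I q)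
  noneAboveIn I p = allB P (λ q → not (ltB P p q) ∨ not (lookup I q))

  allBelowIn⇒ : ∀ {I p} → allBelowIn I p ≡ true → ∀ {q} → q <ₚ p → lookup I q ≡ true
  allBelowIn⇒ {I} {p} below {q} q<p with allB⇒ below q
  ... | holds rewrite <ₚ⇒ltB q<p = holds

  allBelowIn⇐ : ∀ {I p} → (∀ {q} → q <ₚ p → lookup I q ≡ true) → allBelowIn I p ≡ true
  allBelowIn⇐ {I} {p} below = allB⇐ holds
    where
    holds : ∀ q → (not (ltB P q p) ∨ lookup I q) ≡ true
    holds q with ltB P q p in q<p
    ... | false = refl
    ... | true  = below (ltB⇒<ₚ q<p)

  noneAboveIn⇒ : ∀ {I p} → noneAboveIn I p ≡ true → ∀ {q} → p <ₚ q → lookup I q ≡ false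
  noneAboveIn⇒ {I} {p} above {q} p<q with allB⇒ above q
  ... | holds rewrite <ₚ⇒ltB p<q with lookup I q
  ...   | false = refl

  noneAboveIn⇐ : ∀ {I p} → (∀ {q} → p <ₚ q → lookup I q ≡ false) → noneAboveIn I p ≡ true
  noneAboveIn⇐ {I} {p} above = allB⇐ holds
    where
    holds : ∀ q → (not (ltB P p q) ∨ not (lookup I q)) ≡ true
    holds q with ltB P p q in p<q
    ... | false = refl
    ... | true  rewrite above (ltB⇒<ₚ p<q) = refl

  noneAboveIn-false : ∀ {I p q} → p <ₚ q → lookup I q ≡ true → noneAboveIn I p ≡ false
  noneAboveIn-false {I} p<q q∈I = ¬-not λ above → false≢true (trans (sym (noneAboveIn⇒ {I} above p<q)) q∈I)

  private
    bool-ext : ∀ {a b} → (a ≡ true → b ≡ true) → (b ≡ true → a ≡ true) → a ≡ b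
    bool-ext {false} {false} _   _   = refl
    bool-ext {false} {true}  _   b⇒a = b⇒a refl
    bool-ext {true}          a⇒b _   = sym (a⇒b refl)

  allBelowIn-lowerCovers : ∀ {I J p} → IsIdeal I → IsIdeal J →
                           (∀ {z} → z ⋖ₚ p → lookup I z ≡ lookup J z) → allBelowIn I p ≡ allBelowIn J p
  allBelowIn-lowerCovers {I} {J} {p} I-ideal J-ideal agree =
    bool-ext (transfer I J J-ideal agree) (transfer J I I-ideal (sym ∘ agree))
    where
    transfer : ∀ I J → IsIdeal J → (∀ {z} → z ⋖ₚ p → lookup I z ≡ lookup J z) →
               allBelowIn I p ≡ true → allBelowIn J p ≡ true
    transfer I J J-ideal agree below = allBelowIn⇐ {J} λ q<p →
      let (z , q≤z , z⋖p) = ⋖-below q<p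
      in closed J-ideal q≤z (trans (sym (agree z⋖p)) (allBelowIn⇒ {I} below (proj₁ z⋖p)))

  noneAboveIn-upperCovers : ∀ {I J p} → IsIdeal I → IsIdeal J →
                            (∀ {z} → p ⋖ₚ z → lookup I z ≡ lookup J z) → noneAboveIn I p ≡ noneAboveIn J p
  noneAboveIn-upperCovers {I} {J} {p} I-ideal J-ideal agree =
    bool-ext (transfer I J J-ideal agree) (transfer J I I-ideal (sym ∘ agree))
    where
    transfer : ∀ I J → IsIdeal J → (∀ {z} → p ⋖ₚ z → lookup I z ≡ lookup J z) →
               noneAboveIn I p ≡ true → noneAboveIn J p ≡ true
    transfer I J J-ideal agree above = noneAboveIn⇐ {J} λ p<q →
      let (z , p⋖z , z≤q) = ⋖-above p<q
      in closedᶜ J-ideal z≤q (trans (sym (agree p⋖z)) (noneAboveIn⇒ {I} above (proj₁ p⋖z)))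

  toggle-at : ∀ p I → lookup (toggle P p I) p ≡ toggleBit (lookup I p) (allBelowIn I p) (noneAboveIn I p)
  toggle-at p I with lookup I p in p∈I | allBelowIn I p | noneAboveIn I p
  ... | false | false | _     = p∈I
  ... | false | true  | _     = lookup∘updateAt p I
  ... | true  | _     | true  = lookup∘updateAt p I
  ... | true  | _     | false = p∈I

  toggle-other : ∀ p I {q} → q ≢ p → lookup (toggle P p I) q ≡ lookup I q
  toggle-other p I {q} q≢p with canAddB P p I
  ... | true = lookup∘updateAt′ q p q≢p I
  ... | false with canRemoveB P p I
  ...   | true  = lookup∘updateAt′ q p q≢p I
  ...   | false = refl

  toggled-in⇒ : ∀ p I → lookup (toggle P p I) p ≡ true → lookup I p ≡ true ⊎ allBelowIn I p ≡ true
  toggled-in⇒ p I p∈τI = by-membership (lookup I p) refl (trans (sym (toggle-at p I)) p∈τI)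
    where
    by-membership : ∀ b → lookup I p ≡ b → toggleBit b (allBelowIn I p) (noneAboveIn I p) ≡ true →
                    lookup I p ≡ true ⊎ allBelowIn I p ≡ true
    by-membership true  p∈I _     = inj₁ p∈I
    by-membership false _   below = inj₂ below

  toggle-ideal : ∀ p {I} → IsIdeal I → IsIdeal (toggle P p I)
  toggle-ideal p {I} ideal = downClosed closed′
    where
    closed′ : ∀ {x y} → x ≤ₚ y → lookup (toggle P p I) y ≡ true → lookup (toggle P p I) x ≡ true
    closed′ {x} {y} x≤y y∈τI with x Fin.≟ p | y Fin.≟ p
    ... | yes refl | yes refl = y∈τI
    ... | no x≢p   | no y≢p   =
      trans (toggle-other p I x≢p) (closed ideal x≤y (trans (sym (toggle-other p I y≢p)) y∈τI))
    ... | no x≢p   | yes refl =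
      trans (toggle-other p I x≢p)
            ([ closed ideal x≤y , (λ below → allBelowIn⇒ {I} below (x≤y , x≢p)) ] (toggled-in⇒ p I y∈τI))
    ... | yes refl | no y≢p   with trans (sym (toggle-other p I y≢p)) y∈τI
    ...   | y∈I
      rewrite toggle-at p I | closed ideal x≤y y∈I | noneAboveIn-false {I} (x≤y , y≢p ∘ sym) y∈I = refl

module RankedToggles (P : FinPoset) (rk : Fin (n P) → ℕ) (rank : IsRankFunction P rk) where

  open FinPosetProperties P
  open IdealProperties P

  ⋖ₚ⇒rank-suc : ∀ {x y} → x ⋖ₚ y → rk y ≡ suc (rk x)
  ⋖ₚ⇒rank-suc = proj₂ rank _ _

  ⋖ₚ⇒rank≢ : ∀ {x y} → x ⋖ₚ y → rk x ≢ rk y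
  ⋖ₚ⇒rank≢ x⋖y rx≡ry = 1+n≢n (trans (sym (⋖ₚ⇒rank-suc x⋖y)) (sym rx≡ry))

  toggleIfRank : ℕ → Fin (n P) → Sub P → Sub P
  toggleIfRank i p I = if ⌊ rk p ℕ.≟ i ⌋ then toggle P p I else I

  toggleIfRank-ideal : ∀ i p {I} → IsIdeal I → IsIdeal (toggleIfRank i p I)
  toggleIfRank-ideal i p {I} ideal with rk p ℕ.≟ i
  ... | yes _ = toggle-ideal p {I} ideal
  ... | no  _ = ideal

  toggleIfRank-other : ∀ i p I {q} → rk q ≢ i ⊎ q ≢ p → lookup (toggleIfRank i p I) q ≡ lookup I q
  toggleIfRank-other i p I {q} q-untouched with rk p ℕ.≟ i
  ... | no  _      = refl
  ... | yes rp≡i   =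
    toggle-other p I λ { refl → [ (λ rq≢i → rq≢i rp≡i) , (λ q≢p → q≢p refl) ] q-untouched }

  toggleRankAmong : ℕ → List (Fin (n P)) → Sub P → Sub P
  toggleRankAmong i ps I = foldr (toggleIfRank i) I ps

  toggleRankAmong-ideal : ∀ i ps {I} → IsIdeal I → IsIdeal (toggleRankAmong i ps I)
  toggleRankAmong-ideal i []       ideal = ideal
  toggleRankAmong-ideal i (p ∷ ps) ideal = toggleIfRank-ideal i p (toggleRankAmong-ideal i ps ideal)

  toggleRankAmong-other : ∀ i ps I {q} → rk q ≢ i ⊎ q ∉ ps → lookup (toggleRankAmong i ps I) q ≡ lookup I q
  toggleRankAmong-other i []       I q-untouched = refl
  toggleRankAmong-other i (p ∷ ps) I q-untouched = trans
    (toggleIfRank-other i p _ (Sum.map₂ (λ q∉ q≡p → q∉ (here q≡p)) q-untouched))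
    (toggleRankAmong-other i ps I (Sum.map₂ (λ q∉ q∈ → q∉ (there q∈)) q-untouched))

  -- Elements of one rank never cover each other, so the toggles of rank i preceding τ_p leave the
  -- covers of p, hence its addability and removability, unchanged.
  toggleRankAmong-at : ∀ {ps I p} → Unique ps → p ∈ ps → IsIdeal I →
    lookup (toggleRankAmong (rk p) ps I) p ≡ toggleBit (lookup I p) (allBelowIn I p) (noneAboveIn I p)
  toggleRankAmong-at {p ∷ ps} {I} (p∉ps ∷ _) (here refl) ideal = begin
    lookup (toggleIfRank (rk p) p J) p                  ≡⟨ cong (λ K → lookup K p) (toggles-p (rk p ℕ.≟ rk p)) ⟩
    lookup (toggle P p J) p                             ≡⟨ toggle-at p J ⟩
    toggleBit (lookup J p) (allBelowIn J p) (noneAboveIn J p)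
      ≡⟨ cong (λ b → toggleBit b (allBelowIn J p) (noneAboveIn J p))
              (unchanged (inj₂ λ p∈ps → All.lookup p∉ps p∈ps refl)) ⟩
    toggleBit (lookup I p) (allBelowIn J p) (noneAboveIn J p)
      ≡⟨ cong₂ (toggleBit (lookup I p))
           (allBelowIn-lowerCovers J-ideal ideal (λ z⋖p → unchanged (inj₁ (⋖ₚ⇒rank≢ z⋖p))))
           (noneAboveIn-upperCovers J-ideal ideal (λ p⋖z → unchanged (inj₁ (⋖ₚ⇒rank≢ p⋖z ∘ sym)))) ⟩
    toggleBit (lookup I p) (allBelowIn I p) (noneAboveIn I p) ∎
    where
    open ≡-Reasoning
    J : Sub P
    J = toggleRankAmong (rk p) ps I
    J-ideal : IsIdeal J
    J-ideal = toggleRankAmong-ideal (rk p) ps ideal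
    unchanged : ∀ {q} → rk q ≢ rk p ⊎ q ∉ ps → lookup J q ≡ lookup I q
    unchanged = toggleRankAmong-other (rk p) ps I
    toggles-p : ∀ d → (if ⌊ d ⌋ then toggle P p J else J) ≡ toggle P p J
    toggles-p (yes _)  = refl
    toggles-p (no rp≢rp) = contradiction refl rp≢rp
  toggleRankAmong-at {q ∷ ps} {I} {p} (p∉ps ∷ ps-unique) (there p∈ps) ideal = trans
    (toggleIfRank-other (rk p) q _ (inj₂ λ { refl → All.lookup p∉ps p∈ps refl }))
    (toggleRankAmong-at ps-unique p∈ps ideal)

  toggleRank-ideal : ∀ i {I} → IsIdeal I → IsIdeal (toggleRank P rk i I)
  toggleRank-ideal i = toggleRankAmong-ideal i (allFin (n P))

  toggleRank-other : ∀ i I {q} → rk q ≢ i → lookup (toggleRank P rk i I) q ≡ lookup I q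
  toggleRank-other i I rq≢i = toggleRankAmong-other i (allFin (n P)) I (inj₁ rq≢i)

  toggleRank-at : ∀ p {I} → IsIdeal I →
    lookup (toggleRank P rk (rk p) I) p ≡ toggleBit (lookup I p) (allBelowIn I p) (noneAboveIn I p)
  toggleRank-at p = toggleRankAmong-at (allFin⁺ (n P)) (∈-allFin p)

  toggleRanks : List ℕ → Sub P → Sub P
  toggleRanks is I = foldr (toggleRank P rk) I is

  toggleRanks-ideal : ∀ is {I} → IsIdeal I → IsIdeal (toggleRanks is I)
  toggleRanks-ideal []       ideal = ideal
  toggleRanks-ideal (i ∷ is) ideal = toggleRank-ideal i (toggleRanks-ideal is ideal)

  toggleRanks-other : ∀ is I {q} → rk q ∉ is → lookup (toggleRanks is I) q ≡ lookup I q
  toggleRanks-other []       I rq∉is = refl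
  toggleRanks-other (i ∷ is) I rq∉is =
    trans (toggleRank-other i _ (rq∉is ∘ here)) (toggleRanks-other is I (rq∉is ∘ there))

module Rowmotion (P : FinPoset) (rk : Fin (n P) → ℕ) (rank : IsRankFunction P rk)
                 (σ : Permutation′ (suc (maxRank P rk))) where

  open FinPosetProperties P
  open IdealProperties P
  open RankedToggles P rk rank

  Φ : Sub P → Sub P
  Φ = rowmotion P rk σ

  rankOrder : List ℕ
  rankOrder = map (λ s → toℕ (σ ⟨$⟩ʳ s)) (allFin (suc (maxRank P rk)))

  Φ≡toggleRanks : ∀ I → Φ I ≡ toggleRanks rankOrder I
  Φ≡toggleRanks I = sym (foldr-map (toggleRank P rk) (λ s → toℕ (σ ⟨$⟩ʳ s)) I (allFin _))

  Φ-ideal : ∀ {I} → IsIdeal I → IsIdeal (Φ I)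
  Φ-ideal {I} ideal = subst IsIdeal (sym (Φ≡toggleRanks I)) (toggleRanks-ideal rankOrder ideal)

  iterate-Φ-ideal : ∀ {I} → IsIdeal I → ∀ j → IsIdeal (iterate Φ j I)
  iterate-Φ-ideal ideal zero    = ideal
  iterate-Φ-ideal ideal (suc j) = Φ-ideal (iterate-Φ-ideal ideal j)

  rankOrder-unique : Unique rankOrder
  rankOrder-unique = map⁺ σ-injective (allFin⁺ _)
    where
    σ-injective : ∀ {s t} → toℕ (σ ⟨$⟩ʳ s) ≡ toℕ (σ ⟨$⟩ʳ t) → s ≡ t
    σ-injective {s} {t} eq = begin
      s                      ≡⟨ inverseˡ σ ⟨
      σ ⟨$⟩ˡ (σ ⟨$⟩ʳ s)      ≡⟨ cong (σ ⟨$⟩ˡ_) (toℕ-injective eq) ⟩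
      σ ⟨$⟩ˡ (σ ⟨$⟩ʳ t)      ≡⟨ inverseˡ σ ⟩
      t                      ∎
      where open ≡-Reasoning

  rank∈rankOrder : ∀ p → rk p ∈ rankOrder
  rank∈rankOrder p = subst (_∈ rankOrder) σs≡rk (∈-map⁺ _ (∈-allFin s))
    where
    rk<R : rk p ℕ.< suc (maxRank P rk)
    rk<R = s≤s (≤-foldr-⊔ rk (∈-allFin p))
    s : Fin (suc (maxRank P rk))
    s = σ ⟨$⟩ˡ fromℕ< rk<R
    σs≡rk : toℕ (σ ⟨$⟩ʳ s) ≡ rk p
    σs≡rk = trans (cong toℕ (inverseʳ σ)) (toℕ-fromℕ< rk<R)

  module AtElement (p : Fin (n P)) where

    private
      split : ∃₂ λ before after → rankOrder ≡ before ++ rk p ∷ after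
      split = ∈-∃++ (rank∈rankOrder p)

      before after : List ℕ
      before = proj₁ split
      after  = proj₁ (proj₂ split)

      rankOrder≡ : rankOrder ≡ before ++ rk p ∷ after
      rankOrder≡ = proj₂ (proj₂ split)

      rk∉before×rk∉after×disjoint : rk p ∉ before × rk p ∉ after × (∀ {j} → j ∈ after → j ∉ before)
      rk∉before×rk∉after×disjoint = Unique-middle⁻ before (subst Unique rankOrder≡ rankOrder-unique)

    -- foldr applies the ranks listed after rk p first: justBefore I is what τ_{rk p} acts on in Φ I.
    justBefore : Sub P → Sub P
    justBefore = toggleRanks after

    Φ-split : ∀ I → Φ I ≡ toggleRanks before (toggleRank P rk (rk p) (justBefore I))
    Φ-split I = begin
      Φ I                                  ≡⟨ Φ≡toggleRanks I ⟩
      toggleRanks rankOrder I              ≡⟨ cong (λ is → toggleRanks is I) rankOrder≡ ⟩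
      toggleRanks (before ++ rk p ∷ after) I ≡⟨ foldr-++ (toggleRank P rk) I before (rk p ∷ after) ⟩
      toggleRanks before (toggleRank P rk (rk p) (justBefore I)) ∎
      where open ≡-Reasoning

    justBefore-ideal : ∀ {I} → IsIdeal I → IsIdeal (justBefore I)
    justBefore-ideal = toggleRanks-ideal after

    justBefore-at : ∀ I → lookup (justBefore I) p ≡ lookup I p
    justBefore-at I = toggleRanks-other after I (proj₁ (proj₂ rk∉before×rk∉after×disjoint))

    Φ-at : ∀ {I} → IsIdeal I →
      lookup (Φ I) p ≡ toggleBit (lookup I p) (allBelowIn (justBefore I) p) (noneAboveIn (justBefore I) p)
    Φ-at {I} ideal = begin
      lookup (Φ I) p
        ≡⟨ cong (λ J → lookup J p) (Φ-split I) ⟩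
      lookup (toggleRanks before (toggleRank P rk (rk p) (justBefore I))) p
        ≡⟨ toggleRanks-other before _ (proj₁ rk∉before×rk∉after×disjoint) ⟩
      lookup (toggleRank P rk (rk p) (justBefore I)) p
        ≡⟨ toggleRank-at p (justBefore-ideal ideal) ⟩
      toggleBit (lookup (justBefore I) p) (allBelowIn (justBefore I) p) (noneAboveIn (justBefore I) p)
        ≡⟨ cong (λ b → toggleBit b (allBelowIn (justBefore I) p) (noneAboveIn (justBefore I) p))
                (justBefore-at I) ⟩
      toggleBit (lookup I p) (allBelowIn (justBefore I) p) (noneAboveIn (justBefore I) p) ∎
      where open ≡-Reasoning

    allBelowIn-justBefore : ∀ {I} → IsIdeal I → lookup I p ≡ true → allBelowIn (justBefore I) p ≡ true
    allBelowIn-justBefore {I} ideal p∈I = allBelowIn⇐ {justBefore I} λ q<p →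
      closed (justBefore-ideal ideal) (proj₁ q<p) (trans (justBefore-at I) p∈I)

    noneAboveIn-justBefore : ∀ {I} → IsIdeal I → lookup I p ≡ false → noneAboveIn (justBefore I) p ≡ true
    noneAboveIn-justBefore {I} ideal p∉I = noneAboveIn⇐ {justBefore I} λ p<q →
      closedᶜ (justBefore-ideal ideal) (proj₁ p<q) (trans (justBefore-at I) p∉I)

    justBefore-agrees-at-rank : ∀ j →
      (∀ I {q} → rk q ≡ j → lookup (justBefore I) q ≡ lookup I q) ⊎
      (∀ I {q} → rk q ≡ j → rk q ≢ rk p → lookup (justBefore I) q ≡ lookup (Φ I) q)
    justBefore-agrees-at-rank j with j ∈? after
    ... | no  j∉after = inj₁ λ { I refl → toggleRanks-other after I j∉after }
    ... | yes j∈after = inj₂ λ { I {q} refl rq≢rp → sym (begin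
      lookup (Φ I) q
        ≡⟨ cong (λ J → lookup J q) (Φ-split I) ⟩
      lookup (toggleRanks before (toggleRank P rk (rk p) (justBefore I))) q
        ≡⟨ toggleRanks-other before _ (proj₂ (proj₂ rk∉before×rk∉after×disjoint) j∈after) ⟩
      lookup (toggleRank P rk (rk p) (justBefore I)) q
        ≡⟨ toggleRank-other (rk p) (justBefore I) rq≢rp ⟩
      lookup (justBefore I) q ∎) }
      where open ≡-Reasoning

    lowerCover-rank : ∀ {z} → z ⋖ₚ p → rk z ≡ pred (rk p)
    lowerCover-rank z⋖p = cong pred (sym (⋖ₚ⇒rank-suc z⋖p))

    allBelowIn-justBefore≡ : (∀ {I} → IsIdeal I → allBelowIn (justBefore I) p ≡ allBelowIn I p) ⊎
                             (∀ {I} → IsIdeal I → allBelowIn (justBefore I) p ≡ allBelowIn (Φ I) p)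
    allBelowIn-justBefore≡ with justBefore-agrees-at-rank (pred (rk p))
    ... | inj₁ same = inj₁ λ {I} ideal → allBelowIn-lowerCovers (justBefore-ideal ideal) ideal
                                           λ z⋖p → same I (lowerCover-rank z⋖p)
    ... | inj₂ same = inj₂ λ {I} ideal → allBelowIn-lowerCovers (justBefore-ideal ideal) (Φ-ideal ideal)
                                           λ z⋖p → same I (lowerCover-rank z⋖p) (⋖ₚ⇒rank≢ z⋖p)

    noneAboveIn-justBefore≡ : (∀ {I} → IsIdeal I → noneAboveIn (justBefore I) p ≡ noneAboveIn I p) ⊎
                              (∀ {I} → IsIdeal I → noneAboveIn (justBefore I) p ≡ noneAboveIn (Φ I) p)
    noneAboveIn-justBefore≡ with justBefore-agrees-at-rank (suc (rk p))
    ... | inj₁ same = inj₁ λ {I} ideal → noneAboveIn-upperCovers (justBefore-ideal ideal) ideal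
                                           λ p⋖z → same I (⋖ₚ⇒rank-suc p⋖z)
    ... | inj₂ same = inj₂ λ {I} ideal → noneAboveIn-upperCovers (justBefore-ideal ideal) (Φ-ideal ideal)
                                           λ p⋖z → same I (⋖ₚ⇒rank-suc p⋖z) (⋖ₚ⇒rank≢ p⋖z ∘ sym)

    ∑canAdd≡∑canRemove : ∀ {I₀} k → IsIdeal I₀ → iterate Φ k I₀ ≡ I₀ →
      ∑[ j < k ] ⟦ canAddB P p (iterate Φ j I₀) ⟧ ≡ ∑[ j < k ] ⟦ canRemoveB P p (iterate Φ j I₀) ⟧
    ∑canAdd≡∑canRemove {I₀} k I₀-ideal period = Periodic.∑addable≡∑removable k
      (λ j → lookup (X j) p) (λ j → allBelowIn (X j) p) (λ j → noneAboveIn (X j) p)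
      (λ j → allBelowIn (justBefore (X j)) p) (λ j → noneAboveIn (justBefore (X j)) p)
      (cong (λ I → lookup I p) period) (cong (λ I → allBelowIn I p) period) (cong (λ I → noneAboveIn I p) period)
      (λ j → Φ-at (X-ideal j)) (λ j → allBelowIn-justBefore (X-ideal j)) (λ j → noneAboveIn-justBefore (X-ideal j))
      (Sum.map (λ same j → same (X-ideal j)) (λ same j → same (X-ideal j)) allBelowIn-justBefore≡)
      (Sum.map (λ same j → same (X-ideal j)) (λ same j → same (X-ideal j)) noneAboveIn-justBefore≡)
      where
      X : ℕ → Sub P
      X j = iterate Φ j I₀
      X-ideal : ∀ j → IsIdeal (X j)
      X-ideal = iterate-Φ-ideal I₀-ideal

∈-allSubs : ∀ {m} (v : Vec Bool m) → v ∈ allSubs m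
∈-allSubs []          = here refl
∈-allSubs (true  ∷ v) = ∈-++⁺ˡ (∈-map⁺ (true ∷_) (∈-allSubs v))
∈-allSubs (false ∷ v) = ∈-++⁺ʳ _ (∈-map⁺ (false ∷_) (∈-allSubs v))

allSubs-unique : ∀ m → Unique (allSubs m)
allSubs-unique zero    = All.[] AllPairs.∷ AllPairs.[]
allSubs-unique (suc m) =
  ++⁺ (map⁺ ∷-injectiveʳ (allSubs-unique m)) (map⁺ ∷-injectiveʳ (allSubs-unique m)) heads-differ
  where
  heads-differ : Disjoint (map (true ∷_) (allSubs m)) (map (false ∷_) (allSubs m))
  heads-differ (v∈trues , v∈falses) with ∈-map⁻ (true ∷_) v∈trues | ∈-map⁻ (false ∷_) v∈falses
  ... | _ , _ , refl | _ , _ , ()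

idealsJ-unique : ∀ P → Unique (idealsJ P)
idealsJ-unique P = filter⁺ (λ I → isIdealB P I BoolP.≟ true) (allSubs-unique (n P))

∈-idealsJ : ∀ P {I} → isIdealB P I ≡ true → I ∈ idealsJ P
∈-idealsJ P {I} = ∈-filter⁺ (λ I → isIdealB P I BoolP.≟ true) (∈-allSubs I)

expect-indicator : ∀ P (b f : Sub P → Bool) c →
  expect P (λ I → if b I then c else 0ℚ) f ≡ countᵇ (λ I → b I ∧ f I) (idealsJ P) ×ℚ c
expect-indicator P b f c = go (idealsJ P)
  where
  sumOver : List (Sub P) → ℚ
  sumOver = foldr (λ I s → (if b I then c else 0ℚ) ℚ.* boolℚ (f I) ℚ.+ s) 0ℚ
  go : ∀ Is → sumOver Is ≡ countᵇ (λ I → b I ∧ f I) Is ×ℚ c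
  go [] = refl
  go (I ∷ Is) with b I | f I
  ... | true  | true  = cong₂ ℚ._+_ (ℚP.*-identityʳ c) (go Is)
  ... | true  | false = trans (cong (ℚ._+ sumOver Is) (ℚP.*-zeroʳ c)) (trans (ℚP.+-identityˡ _) (go Is))
  ... | false | fI    = trans (cong (ℚ._+ sumOver Is) (ℚP.*-zeroˡ (boolℚ fI))) (trans (ℚP.+-identityˡ _) (go Is))

expect-uniformOnOrbit : ∀ P (Φ : Sub P → Sub P) I₀ m →
  (∀ j → isIdealB P (iterate Φ j I₀) ≡ true) →
  iterate Φ (suc m) I₀ ≡ I₀ → (∀ j → 0 < j → j < suc m → iterate Φ j I₀ ≢ I₀) →
  ∀ f → expect P (uniformOnOrbit P Φ I₀ (suc m)) f
        ≡ (∑[ j < suc m ] ⟦ f (iterate Φ j I₀) ⟧) ×ℚ ((ℤ.+ 1) ℚ./ suc m)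
expect-uniformOnOrbit P Φ I₀ m ideal period minimal f = begin
  expect P (uniformOnOrbit P Φ I₀ (suc m)) f
    ≡⟨ expect-indicator P (_∈ᵇ orbit) f c ⟩
  countᵇ (λ I → I ∈ᵇ orbit ∧ f I) (idealsJ P) ×ℚ c
    ≡⟨ cong (_×ℚ c) (countᵇ-∈ᵇ (idealsJ-unique P) (orbitList-unique Φ I₀ (suc m) period minimal) orbit⊆J f) ⟩
  countᵇ f orbit ×ℚ c
    ≡⟨ cong (_×ℚ c) (countᵇ-orbitList f Φ I₀ (suc m)) ⟩
  (∑[ j < suc m ] ⟦ f (iterate Φ j I₀) ⟧) ×ℚ c ∎
  where
  open ≡-Reasoning
  open MembershipCount (VecP.≡-dec BoolP._≟_)
  c : ℚ
  c = (ℤ.+ 1) ℚ./ suc m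
  orbit : List (Sub P)
  orbit = orbitList Φ I₀ (suc m)
  orbit⊆J : All (_∈ idealsJ P) orbit
  orbit⊆J = AllP.map⁺ (AllP.applyUpTo⁺₂ id (suc m) (λ j → ∈-idealsJ P (ideal j)))

lemma7p7 : (P : FinPoset) → Connected P →
    (rk : Fin (n P) → ℕ) → IsRankFunction P rk →
    (σ : Permutation′ (suc (maxRank P rk))) →
    (I₀ : Sub P) → isIdealB P I₀ ≡ true →
    (m : ℕ) →
    iterate (rowmotion P rk σ) (suc m) I₀ ≡ I₀ →
    (∀ j → 0 < j → j < suc m → iterate (rowmotion P rk σ) j I₀ ≢ I₀) →
    ToggleSymmetric P (uniformOnOrbit P (rowmotion P rk σ) I₀ (suc m))
lemma7p7 P _ rk rank σ I₀ I₀-idealB m period minimal p = begin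
  expect P μ (canAddB P p)                                    ≡⟨ expect≡ (canAddB P p) ⟩
  (∑[ j < suc m ] ⟦ canAddB P p (iterate Φ j I₀) ⟧) ×ℚ c
    ≡⟨ cong (_×ℚ c) (AtElement.∑canAdd≡∑canRemove p (suc m) I₀-ideal period) ⟩
  (∑[ j < suc m ] ⟦ canRemoveB P p (iterate Φ j I₀) ⟧) ×ℚ c  ≡⟨ expect≡ (canRemoveB P p) ⟨
  expect P μ (canRemoveB P p)                                 ∎
  where
  open ≡-Reasoning
  open IdealProperties P
  open Rowmotion P rk rank σ
  μ : Distribution P
  μ = uniformOnOrbit P Φ I₀ (suc m)
  c : ℚ
  c = (ℤ.+ 1) ℚ./ suc m
  I₀-ideal : IsIdeal I₀
  I₀-ideal = isIdealB⇒ I₀-idealB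
  expect≡ : ∀ f → expect P μ f ≡ (∑[ j < suc m ] ⟦ f (iterate Φ j I₀) ⟧) ×ℚ c
  expect≡ = expect-uniformOnOrbit P Φ I₀ m (isIdealB⇐ ∘ iterate-Φ-ideal I₀-ideal) period minimal
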